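{- Let $r_1,r_2,r_3$ be positive integers with $r_1\ge 2$ and $\gcd(r_1,r_2)=\gcd(r_1,r_3)=1$, and suppose $r_1r_2+r_3=p^2$ for a prime $p$. If $p-1$ is not divisible by $r_1$, then $Q(r_1,r_2,r_3)=0$, i.e. there is no pair $(k,g)$ with $k\in\mathbb{Z}$, $g$ a positive integer, $g+1\ne r_1r_2+r_3$, such that $r_1r_2+r_1^2k=g\,(r_3-r_1^2k)$.
   Context: $Q(r_1,r_2,r_3)$ denotes the number of pairs $(k,g)$, $k\in\mathbb{Z}$, $g\in\mathbb{Z}_{>0}$, satisfying $r_1r_2+r_1^2k=g(r_3-r_1^2k)$ and for which the reduced semigroup ${\sf S}(r_1^2,r_3-r_1^2k)$ has a nonempty set of gaps; equivalently, the solutions with $X=g+1$ a divisor of $r_1r_2+r_3$ other than $1$ and $r_1r_2+r_3$ itself (the latter choice would give $r_3-r_1^2k=1$). -}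

module Defs where

open import Data.Integer using (ℤ; +_; _+_; _-_; _*_)
open import Data.Nat using (ℕ; suc)
open import Relation.Binary.PropositionalEquality using (_≡_)
open import Relation.Nullary using (¬_)
open import Data.Product using (_×_)

-- A pair (k , g) with k ∈ ℤ, g ∈ ℤ_{>0} (g = suc g' for g' : ℕ) counted by Q(r1,r2,r3):
-- r1 r2 + r1^2 k = g (r3 - r1^2 k), and g + 1 ≠ r1 r2 + r3
-- (the latter excludes the case r3 - r1^2 k = 1, whose semigroup has no gaps).
QPair : ℕ → ℕ → ℕ → ℤ → ℕ → Set
QPair r₁ r₂ r₃ k g' =
  let R₁ = + r₁ ; R₂ = + r₂ ; R₃ = + r₃ ; g = + suc g' in
  (R₁ * R₂ + R₁ * R₁ * k ≡ g * (R₃ - R₁ * R₁ * k))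
  × ¬ (g + + 1 ≡ R₁ * R₂ + R₃)

module Submission where

-- Put X = g + 1 and let d = r₃ - r₁²k be the modulus of a
-- hypothetical Q-pair (k , g).  Adding r₃ - r₁²k to both sides of the
-- defining equation gives the factorisation  p² = r₁r₂ + r₃ = X · d.
-- Since X > 0 the modulus d is a natural number, and the side conditions
-- X ≠ 1 (because g > 0) and X ≠ p² (i.e. d ≠ 1) leave only X = d = p.
-- The defining equation now reads r₁(r₂ + r₁k) = g·p, so r₁ ∣ g·p.
-- Moreover p ∤ r₁: otherwise p would divide r₃ = p + r₁²k as well,
-- contradicting gcd(r₁ , r₃) = 1.  Hence r₁ is coprime to p, so r₁ ∣ g = p - 1,
-- against the hypothesis.

open import Defs
open import Data.Nat using (ℕ; _*_; _+_; _≤_; _∸_)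
open import Data.Nat.GCD using (gcd)
open import Data.Nat.Divisibility using (_∣_)
open import Data.Nat.Primality using (Prime)
open import Data.Integer using (ℤ)
open import Relation.Binary.PropositionalEquality using (_≡_)
open import Relation.Nullary using (¬_)

open import Data.Nat using (suc; NonZero)
open import Data.Nat.Properties using (*-cancelʳ-≡; *-cancelˡ-≡; *-identityˡ; *-identityʳ; *-comm; *-assoc)
open import Data.Nat.Divisibility using (divides)
open import Data.Nat.Primality using (euclidsLemma; prime⇒irreducible; prime⇒nonZero; ¬prime[1])
open import Data.Nat.Coprimality using (Coprime; coprime-divisor; gcd≡1⇒coprime)
open import Data.Integer using (+_; -[1+_])
import Data.Integer as ℤ
open import Data.Integer.Properties using (pos-*; +-injective) renaming (+-comm to ℤ+-comm)
open import Data.Integer.Divisibility.Signed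
  using (∣ᵤ⇒∣; ∣⇒∣ᵤ; ∣-refl; ∣m⇒∣m*n; ∣m∣n⇒∣m+n)
  renaming (_∣_ to _∣ℤ_)
open import Data.Integer.Tactic.RingSolver using (solve-∀)
open import Data.Product using (Σ; _×_; _,_)
open import Data.Sum using (_⊎_; inj₁; inj₂)
open import Data.Empty using (⊥-elim)
open import Relation.Binary.PropositionalEquality using (refl; sym; trans; cong; subst; module ≡-Reasoning)

qpair-factorisation : ∀ (a r m g : ℤ) → a ℤ.+ m ≡ g ℤ.* (r ℤ.- m) →
  a ℤ.+ r ≡ (+ 1 ℤ.+ g) ℤ.* (r ℤ.- m)
qpair-factorisation a r m g eq = begin
  a ℤ.+ r                              ≡⟨ regroup a r m ⟩
  (a ℤ.+ m) ℤ.+ (r ℤ.- m)              ≡⟨ cong (ℤ._+ (r ℤ.- m)) eq ⟩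
  g ℤ.* (r ℤ.- m) ℤ.+ (r ℤ.- m)        ≡⟨ collect g (r ℤ.- m) ⟩
  (+ 1 ℤ.+ g) ℤ.* (r ℤ.- m)            ∎
  where
  open ≡-Reasoning
  regroup : ∀ (a r m : ℤ) → a ℤ.+ r ≡ (a ℤ.+ m) ℤ.+ (r ℤ.- m)
  regroup = solve-∀
  collect : ∀ (g x : ℤ) → g ℤ.* x ℤ.+ x ≡ (+ 1 ℤ.+ g) ℤ.* x
  collect = solve-∀

nonneg-cofactor : ∀ n c (x : ℤ) → + n ≡ + suc c ℤ.* x →
  Σ ℕ λ d → x ≡ + d × n ≡ suc c * d
nonneg-cofactor n c (+ d) eq = d , refl , +-injective (trans eq (sym (pos-* (suc c) d)))
nonneg-cofactor n c -[1+ d ] ()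

prime-square-cofactor : ∀ {p a b} → Prime p → p * p ≡ a * b → p ∣ b →
  a ≡ 1 ⊎ (a ≡ p × b ≡ p)
prime-square-cofactor {p} {a} pp eq (divides e refl) =
  by-irreducibility (prime⇒irreducible pp (divides e (trans p≡ae (*-comm a e))))
  where
  instance
    p≢0 : NonZero p
    p≢0 = prime⇒nonZero pp
  p≡ae : p ≡ a * e
  p≡ae = *-cancelʳ-≡ p (a * e) p (trans eq (sym (*-assoc a e p)))
  by-irreducibility : a ≡ 1 ⊎ a ≡ p → a ≡ 1 ⊎ (a ≡ p × e * p ≡ p)
  by-irreducibility (inj₁ a≡1) = inj₁ a≡1
  by-irreducibility (inj₂ a≡p) = inj₂ (a≡p , trans (cong (_* p) e≡1) (*-identityˡ p))
    where
    e≡1 : e ≡ 1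
    e≡1 = *-cancelˡ-≡ e 1 p (trans (sym (subst (λ x → p ≡ x * e) a≡p p≡ae)) (sym (*-identityʳ p)))

prime-square-factors : ∀ {p a b} → Prime p → p * p ≡ a * b →
  ¬ a ≡ 1 → ¬ b ≡ 1 → a ≡ p × b ≡ p
prime-square-factors {p} {a} {b} pp eq a≢1 b≢1
  with euclidsLemma a b pp (divides p (sym eq))
... | inj₂ p∣b with prime-square-cofactor pp eq p∣b
...   | inj₁ a≡1 = ⊥-elim (a≢1 a≡1)
...   | inj₂ both = both
prime-square-factors {p} {a} {b} pp eq a≢1 b≢1
    | inj₁ p∣a with prime-square-cofactor pp (trans eq (*-comm a b)) p∣a
...   | inj₁ b≡1 = ⊥-elim (b≢1 b≡1)
...   | inj₂ (b≡p , a≡p) = a≡p , b≡p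

divides-r·a+r²k : ∀ r n (a k : ℤ) → + r ℤ.* a ℤ.+ + r ℤ.* + r ℤ.* k ≡ + n → r ∣ n
divides-r·a+r²k r n a k eq = ∣⇒∣ᵤ (subst (+ r ∣ℤ_) eq
  (∣m∣n⇒∣m+n (∣m⇒∣m*n a ∣-refl) (∣m⇒∣m*n k (∣m⇒∣m*n (+ r) ∣-refl))))

modulus-divisor : ∀ q r₁ r₃ (k : ℤ) → + r₃ ℤ.- + r₁ ℤ.* + r₁ ℤ.* k ≡ + q →
  q ∣ r₁ → q ∣ r₃
modulus-divisor q r₁ r₃ k eq q∣r₁ = ∣⇒∣ᵤ (subst (+ q ∣ℤ_) r₃≡q+m
  (∣m∣n⇒∣m+n ∣-refl (∣m⇒∣m*n k (∣m⇒∣m*n (+ r₁) (∣ᵤ⇒∣ {+ q} {+ r₁} q∣r₁)))))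
  where
  m : ℤ
  m = + r₁ ℤ.* + r₁ ℤ.* k
  split : ∀ (r m : ℤ) → (r ℤ.- m) ℤ.+ m ≡ r
  split = solve-∀
  r₃≡q+m : + q ℤ.+ m ≡ + r₃
  r₃≡q+m = trans (cong (ℤ._+ m) (sym eq)) (split (+ r₃) m)

coprime-to-prime : ∀ {n p} → Prime p → ¬ p ∣ n → Coprime n p
coprime-to-prime pp p∤n {i} (i∣n , i∣p) with prime⇒irreducible pp i∣p
... | inj₁ i≡1 = i≡1
... | inj₂ refl = ⊥-elim (p∤n i∣n)

corollary2 : (r₁ r₂ r₃ p : ℕ) → 2 ≤ r₁ → 1 ≤ r₂ → 1 ≤ r₃ →
    gcd r₁ r₂ ≡ 1 → gcd r₁ r₃ ≡ 1 →
    Prime p → r₁ * r₂ + r₃ ≡ p * p →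
    ¬ (r₁ ∣ (p ∸ 1)) →
    (k : ℤ) (g' : ℕ) → ¬ QPair r₁ r₂ r₃ k g'
corollary2 r₁ r₂ r₃ p _ _ _ _ gcd₁₃≡1 pp sum r₁∤p-1 k g' (qeq , X≢sum) =
  r₁∤p-1 (from-cofactor (nonneg-cofactor (p * p) (suc g') modulus p²≡X·modulus))
  where
  r₁²k : ℤ
  r₁²k = + r₁ ℤ.* + r₁ ℤ.* k
  modulus : ℤ
  modulus = + r₃ ℤ.- r₁²k
  sumℤ : + r₁ ℤ.* + r₂ ℤ.+ + r₃ ≡ + (p * p)
  sumℤ = trans (cong (ℤ._+ + r₃) (sym (pos-* r₁ r₂))) (cong +_ sum)
  p²≡X·modulus : + (p * p) ≡ + (2 + g') ℤ.* modulus
  p²≡X·modulus = trans (sym sumℤ) (qpair-factorisation (+ r₁ ℤ.* + r₂) (+ r₃) r₁²k (+ suc g') qeq)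
  -- X = g + 1 must equal p, and then r₁ ∣ g = p - 1.
  from-cofactor : Σ ℕ (λ d → modulus ≡ + d × p * p ≡ (2 + g') * d) → r₁ ∣ p ∸ 1
  from-cofactor (d , modulus≡d , p²≡Xd) with prime-square-factors pp p²≡Xd (λ ()) d≢1
    where
    d≢1 : ¬ d ≡ 1
    d≢1 refl = X≢sum (trans (ℤ+-comm (+ suc g') (+ 1))
      (trans (cong +_ (trans (sym (*-identityʳ (2 + g'))) (sym p²≡Xd))) (sym sumℤ)))
  ... | X≡p , d≡p = subst (r₁ ∣_) (cong (_∸ 1) X≡p) (coprime-divisor r₁⊥p r₁∣p·g)
    where
    modulus≡p : modulus ≡ + p
    modulus≡p = trans modulus≡d (cong +_ d≡p)
    r₁∣p·g : r₁ ∣ p * suc g'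
    r₁∣p·g = subst (r₁ ∣_) (*-comm (suc g') p) (divides-r·a+r²k r₁ (suc g' * p) (+ r₂) k
      (trans qeq (trans (cong (+ suc g' ℤ.*_) modulus≡p) (sym (pos-* (suc g') p)))))
    r₁⊥p : Coprime r₁ p
    r₁⊥p = coprime-to-prime pp λ p∣r₁ → ¬prime[1] (subst Prime
      (gcd≡1⇒coprime gcd₁₃≡1 (p∣r₁ , modulus-divisor p r₁ r₃ k modulus≡p p∣r₁)) pp)
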